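{- Let $p$ be a prime, $\ell\ge1$, and let $f\in P_{p^\ell}$ be nilpotent with leading component $e_\gamma$ of its generating vector. Then, for all sufficiently large $t$, $\tau\big(\sum_{i=0}^t\Sigma^if\big)=\tau\big(\Sigma^{t+\gamma}[e_\gamma]\big)$.
   Context: $P_{p^\ell}$ is the module of periodic sequences $\mathbb{N}\to\mathbb{Z}_{p^\ell}$, and $\tau$ denotes the minimal period. $\Delta f(n)=f(n+1)-f(n)$. A sequence is nilpotent if $\Delta^\eta f=0$ for some $\eta\ge1$, with minimal such $\eta$ its nilpotency index. The generating vector is $(e_0,\dots,e_{\eta-1})$ with $e_i=\Delta^if(0)$. Its leading component is the last entry with minimal $p$-adic valuation, where the valuation of $0\in\mathbb{Z}_{p^\ell}$ is $\infty$. $[c]$ is the constant sequence with value $c$. $\Sigma$ is the sum operator $\Sigma f(0)=0$, $\Sigma f(n)=f(n-1)+\Sigma f(n-1)$, and $\Sigma^0=\mathrm{id}$. -}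

module Defs where

open import Data.Nat as ℕ using (ℕ; zero; suc; _^_; _≤_; _<_)
open import Data.Nat.Divisibility using (_∣_; _∣?_)
open import Data.Integer as ℤ using (ℤ; ∣_∣; 0ℤ)
open import Data.Product using (_×_; Σ; ∃)
open import Relation.Nullary using (yes; no)
open import Function using (_∘_)

-- Sequences ℕ → ℤ_m are represented by integer-valued sequences ℕ → ℤ,
-- with all equalities taken modulo m (congruence).
Seq : Set
Seq = ℕ → ℤ

_≡[_]_ : ℤ → ℕ → ℤ → Set
a ≡[ m ] b = m ∣ ∣ a ℤ.- b ∣

iter : ℕ → (Seq → Seq) → Seq → Seq
iter zero    F g = g
iter (suc k) F g = F (iter k F g)

Δ : Seq → Seq
Δ f n = f (suc n) ℤ.- f n

Σop : Seq → Seq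
Σop f zero    = 0ℤ
Σop f (suc n) = f n ℤ.+ Σop f n

const[_] : ℤ → Seq
const[ c ] _ = c

sumΣ : Seq → ℕ → Seq
sumΣ f zero    n = f n
sumΣ f (suc t) n = sumΣ f t n ℤ.+ iter (suc t) Σop f n

IsPeriod : ℕ → Seq → ℕ → Set
IsPeriod m g τ = ∀ n → g (n ℕ.+ τ) ≡[ m ] g n

Periodic : ℕ → Seq → Set
Periodic m g = Σ ℕ λ τ → (1 ≤ τ) × IsPeriod m g τ

IsMinPeriod : ℕ → Seq → ℕ → Set
IsMinPeriod m g τ = (1 ≤ τ) × IsPeriod m g τ
                  × (∀ τ′ → 1 ≤ τ′ → IsPeriod m g τ′ → τ ≤ τ′)

NilpotentAt : ℕ → Seq → ℕ → Set
NilpotentAt m f η = ∀ n → iter η Δ f n ≡[ m ] 0ℤ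

IsNilIndex : ℕ → Seq → ℕ → Set
IsNilIndex m f η = (1 ≤ η) × NilpotentAt m f η
                 × (∀ η′ → 1 ≤ η′ → NilpotentAt m f η′ → η ≤ η′)

genComp : Seq → ℕ → ℤ
genComp f i = iter i Δ f 0

maxPowDiv : ℕ → ℕ → ℕ → ℕ
maxPowDiv p zero    n = zero
maxPowDiv p (suc k) n with (p ^ suc k) ∣? n
... | yes _ = suc k
... | no  _ = maxPowDiv p k n

-- p-adic valuation on ℤ_{p^ℓ} of the class of x, with ∞ (the valuation of 0)
-- encoded as ℓ; valuations of nonzero elements lie in {0,…,ℓ-1}, so this
-- encoding preserves the order on ℕ ∪ {∞}.
val : ℕ → ℕ → ℤ → ℕ
val p ℓ x = maxPowDiv p ℓ ∣ x ∣

-- e_γ is the leading component of the generating vector (e_0,…,e_{η-1}):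
-- the last entry with minimal valuation.
IsLeading : ℕ → ℕ → Seq → ℕ → ℕ → Set
IsLeading p ℓ f η γ =
  (γ < η)
  × (∀ i → i < η → val p ℓ (genComp f γ) ≤ val p ℓ (genComp f i))
  × (∀ i → γ < i → i < η → val p ℓ (genComp f γ) < val p ℓ (genComp f i))

-- Every sequence g is its Newton series g n = ∑ᵢ cᵢ · C(n, i) with cᵢ = Δⁱ g 0, the operator Σ
-- shifts the coefficients, and so both ∑_{i ≤ t} Σⁱ f and Σ^{t+γ} [e_γ] are Newton series whose
-- coefficients have p-adic valuation ≥ v everywhere, > v beyond the index m = t + γ, exactly v at m
-- (v being the valuation of e_γ), and ≥ ℓ from an index B on, with B ≤ m + p^L once t ≥ p η,
-- where p^L ≤ m < p^(L+1).  For any such coefficient sequence the minimal period modulo p^ℓ is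
-- p^(ℓ - v + L): τ is a period iff p^ℓ divides each ∑_{0<j≤τ} c_{k+j} C(τ, j).  If p^(ℓ-v+L) ∣ τ
-- then every term is divisible by p^ℓ, because v_p C(τ, j) ≥ v_p τ - v_p j; otherwise, writing
-- v_p τ = w + r with r ≤ L, at k = m - p^r every term except c_m C(τ, p^r) is divisible by
-- p^(v+w+1), while that one has valuation exactly v + w < ℓ.  If v = ℓ both sequences vanish.

module Submission where

open import Defs
open import Data.Nat using (ℕ; _^_)
open import Data.Nat.Primality using (Prime)

module Binomial where

  open import Data.Nat
  open import Data.Nat.Properties
  open import Data.Nat.Combinatorics
  open import Relation.Binary.PropositionalEquality

  C-absorption : ∀ n k → suc k * (suc n C suc k) ≡ suc n * (n C k)
  C-absorption zero    zero    = refl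
  C-absorption zero    (suc k) = *-zeroʳ (2 + k)
  C-absorption (suc n) zero    =
    trans (+-identityʳ ((2 + n) C 1)) (trans (nC1≡n (2 + n)) (sym (*-identityʳ (2 + n))))
  C-absorption (suc n) (suc k) = begin
    (2 + k) * ((2 + n) C (2 + k))
      ≡⟨ cong ((2 + k) *_) (nCk+nC[k+1]≡[n+1]C[k+1] (1 + n) (1 + k)) ⟨
    (2 + k) * (A + B)
      ≡⟨ *-distribˡ-+ (2 + k) A B ⟩
    A + (1 + k) * A + (2 + k) * B
      ≡⟨ cong₂ (λ a b → A + a + b) (C-absorption n k) (C-absorption n (suc k)) ⟩
    A + (1 + n) * (n C k) + (1 + n) * (n C (1 + k))
      ≡⟨ +-assoc A _ _ ⟩
    A + ((1 + n) * (n C k) + (1 + n) * (n C (1 + k)))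
      ≡⟨ cong (A +_) (*-distribˡ-+ (1 + n) (n C k) _) ⟨
    A + (1 + n) * (n C k + n C (1 + k))
      ≡⟨ cong (λ a → A + (1 + n) * a) (nCk+nC[k+1]≡[n+1]C[k+1] n k) ⟩
    (2 + n) * A ∎
    where
    open ≡-Reasoning
    A = (1 + n) C (1 + k)
    B = (1 + n) C (2 + k)


module PAdic {p : ℕ} (p-prime : Prime p) where

  open import Data.Nat
  open import Data.Nat.Properties
  open import Data.Nat.Divisibility
  open import Data.Nat.Primality
  open import Data.Nat.Combinatorics
  open import Data.Nat.Tactic.RingSolver using (solve-∀)
  open import Data.Product using (∃; _×_; _,_)
  open import Data.Sum using (inj₁; inj₂)
  open import Relation.Nullary using (¬_; yes; no; contradiction)
  open import Relation.Binary.PropositionalEquality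
  open Binomial

  instance
    p≢0 : NonZero p
    p≢0 = prime⇒nonZero p-prime

  1<p : 1 < p
  1<p = nonTrivial⇒n>1 p {{prime⇒nonTrivial p-prime}}

  p∤1 : ¬ p ∣ 1
  p∤1 p∣1 = <⇒≢ 1<p (sym (∣1⇒≡1 p∣1))

  p^-mono-∣ : ∀ {i j} → i ≤ j → p ^ i ∣ p ^ j
  p^-mono-∣ {i} i≤j with m≤n⇒∃[o]m+o≡n i≤j
  ... | o , refl = divides (p ^ o) (trans (^-distribˡ-+-* p i o) (*-comm (p ^ i) (p ^ o)))

  p^n+p^n≤p^[1+n] : ∀ n → p ^ n + p ^ n ≤ p ^ suc n
  p^n+p^n≤p^[1+n] n = begin
    p ^ n + p ^ n       ≡⟨ cong (p ^ n +_) (+-identityʳ (p ^ n)) ⟨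
    2 * p ^ n           ≤⟨ *-monoˡ-≤ (p ^ n) 1<p ⟩
    p ^ suc n           ∎
    where open ≤-Reasoning

  B≤m+p^L⇒B+p^L≤m+p^[1+L] : ∀ {B m} L → B ≤ m + p ^ L → B + p ^ L ≤ m + p ^ suc L
  B≤m+p^L⇒B+p^L≤m+p^[1+L] {B} {m} L B≤m+p^L = begin
    B + p ^ L              ≤⟨ +-monoˡ-≤ (p ^ L) B≤m+p^L ⟩
    m + p ^ L + p ^ L      ≡⟨ +-assoc m (p ^ L) (p ^ L) ⟩
    m + (p ^ L + p ^ L)    ≤⟨ +-monoʳ-≤ m (p^n+p^n≤p^[1+n] L) ⟩
    m + p ^ suc L          ∎
    where open ≤-Reasoning

  n<p^n : ∀ n → n < p ^ n
  n<p^n zero    = s≤s z≤n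
  n<p^n (suc n) = begin-strict
    suc n               <⟨ s≤s (n<p^n n) ⟩
    suc (p ^ n)         ≤⟨ +-monoˡ-≤ (p ^ n) (m^n>0 p n) ⟩
    p ^ n + p ^ n       ≤⟨ p^n+p^n≤p^[1+n] n ⟩
    p ^ suc n           ∎
    where open ≤-Reasoning

  p^-bracket : ∀ {m} → 1 ≤ m → ∃ λ L → p ^ L ≤ m × m < p ^ suc L
  p^-bracket {m} 1≤m = search m (n<p^n m)
    where
    search : ∀ B → m < p ^ B → ∃ λ L → p ^ L ≤ m × m < p ^ suc L
    search zero    m<1 = contradiction m<1 (≤⇒≯ 1≤m)
    search (suc B) m<p^[1+B] with m <? p ^ B
    ... | yes m<p^B = search B m<p^B
    ... | no  m≮p^B = B , ≮⇒≥ m≮p^B , m<p^[1+B]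

  0<j<p^k⇒p^k∤j : ∀ {j} k → 0 < j → j < p ^ k → ¬ p ^ k ∣ j
  0<j<p^k⇒p^k∤j {suc j} k _ j<p^k p^k∣j = <⇒≱ j<p^k (∣⇒≤ p^k∣j)

  p∤m*n : ∀ {m n} → ¬ p ∣ m → ¬ p ∣ n → ¬ p ∣ m * n
  p∤m*n {m} {n} p∤m p∤n p∣mn with euclidsLemma m n p-prime p∣mn
  ... | inj₁ p∣m = p∤m p∣m
  ... | inj₂ p∣n = p∤n p∣n

  p∤m∧p^k∣m*n⇒p^k∣n : ∀ {m n} k → ¬ p ∣ m → p ^ k ∣ m * n → p ^ k ∣ n
  p∤m∧p^k∣m*n⇒p^k∣n         zero    _   _       = 1∣ _
  p∤m∧p^k∣m*n⇒p^k∣n {m} {n} (suc k) p∤m p^k+1∣mn with euclidsLemma m n p-prime (m*n∣⇒m∣ p (p ^ k) p^k+1∣mn)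
  ... | inj₁ p∣m            = contradiction p∣m p∤m
  ... | inj₂ (divides q refl) =
    subst (p ^ suc k ∣_) (*-comm p q) (*-monoʳ-∣ p (p∤m∧p^k∣m*n⇒p^k∣n k p∤m (*-cancelˡ-∣ p p∣p*[m*q])))
    where
    p∣p*[m*q] : p * p ^ k ∣ p * (m * q)
    p∣p*[m*q] = subst (p * p ^ k ∣_) (trans (sym (*-assoc m q p)) (*-comm (m * q) p)) p^k+1∣mn

  p^[x+y]∣j*n⇒p^x∣n : ∀ {j n} x y → ¬ p ^ suc y ∣ j → p ^ (x + y) ∣ j * n → p ^ x ∣ n
  p^[x+y]∣j*n⇒p^x∣n {j} x y _ p^[x+y]∣jn with p ∣? j
  ... | no p∤j = ∣-trans (p^-mono-∣ (m≤m+n x y)) (p∤m∧p^k∣m*n⇒p^k∣n (x + y) p∤j p^[x+y]∣jn)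
  p^[x+y]∣j*n⇒p^x∣n x zero p^1∤j _ | yes p∣j =
    contradiction (subst (_∣ _) (sym (*-identityʳ p)) p∣j) p^1∤j
  p^[x+y]∣j*n⇒p^x∣n {n = n} x (suc y) p^[2+y]∤j p^[x+1+y]∣jn | yes (divides q refl) =
    p^[x+y]∣j*n⇒p^x∣n x y p^[1+y]∤q (*-cancelˡ-∣ p (subst₂ _∣_ (cong (p ^_) (+-suc x y)) reassoc p^[x+1+y]∣jn))
    where
    p^[1+y]∤q : ¬ p ^ suc y ∣ q
    p^[1+y]∤q p^[1+y]∣q = p^[2+y]∤j (subst (p ^ suc (suc y) ∣_) (*-comm p q) (*-monoʳ-∣ p p^[1+y]∣q))
    reassoc : q * p * n ≡ p * (q * n)
    reassoc = trans (cong (_* n) (*-comm q p)) (*-assoc p q n)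

  p^[x+y]∣τ⇒p^x∣τCj : ∀ {τ j} x y → p ^ (x + y) ∣ τ → 0 < j → j < p ^ suc y → p ^ x ∣ τ C j
  p^[x+y]∣τ⇒p^x∣τCj {zero}  {suc i} x y _ _ _ = (p ^ x) ∣0
  p^[x+y]∣τ⇒p^x∣τCj {suc N} {suc i} x y p^[x+y]∣τ 0<j j<p^[1+y] =
    p^[x+y]∣j*n⇒p^x∣n x y (0<j<p^k⇒p^k∤j (suc y) 0<j j<p^[1+y])
      (subst (p ^ (x + y) ∣_) (sym (C-absorption N i)) (∣m⇒∣m*n (N C i) p^[x+y]∣τ))

  p^r∣1+N⇒p∤NCi : ∀ {N i} r → p ^ r ∣ suc N → i < p ^ r → ¬ p ∣ N C i
  p^r∣1+N⇒p∤NCi {i = zero}  _       _ _          = p∤1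
  p^r∣1+N⇒p∤NCi {i = suc i} zero    _ (s≤s ())
  p^r∣1+N⇒p∤NCi {N} {suc i} (suc r) p^[1+r]∣1+N 1+i<p^[1+r] p∣NC[1+i] =
    p^r∣1+N⇒p∤NCi (suc r) p^[1+r]∣1+N (<-trans (n<1+n i) 1+i<p^[1+r]) p∣NCi
    where
    p∣[1+N]C[1+i] : p ∣ suc N C suc i
    p∣[1+N]C[1+i] = subst (_∣ _) (*-identityʳ p) (p^[x+y]∣τ⇒p^x∣τCj 1 r p^[1+r]∣1+N (s≤s z≤n) 1+i<p^[1+r])
    p∣NCi : p ∣ N C i
    p∣NCi = ∣m+n∣m⇒∣n (subst (p ∣_) pascal p∣[1+N]C[1+i]) p∣NC[1+i]
      where
      pascal : suc N C suc i ≡ N C suc i + N C i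
      pascal = trans (sym (nCk+nC[k+1]≡[n+1]C[k+1] N i)) (+-comm (N C i) _)

  record IsValuation (x a : ℕ) : Set where
    constructor exactly
    field
      cofactor   : ℕ
      factorises : x ≡ p ^ a * cofactor
      coprime    : ¬ p ∣ cofactor

  IsValuation⇒∣ : ∀ {x a} → IsValuation x a → p ^ a ∣ x
  IsValuation⇒∣ {a = a} (exactly x′ refl _) = divides x′ (*-comm (p ^ a) x′)

  IsValuation⇒∤ : ∀ {x a} → IsValuation x a → ¬ p ^ suc a ∣ x
  IsValuation⇒∤ {a = a} (exactly x′ refl p∤x′) p^[1+a]∣x =
    p∤x′ (*-cancelˡ-∣ (p ^ a) {{m^n≢0 p a}} (subst (_∣ p ^ a * x′) (*-comm p (p ^ a)) p^[1+a]∣x))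

  ∣∧∤⇒IsValuation : ∀ {x a} → p ^ a ∣ x → ¬ p ^ suc a ∣ x → IsValuation x a
  ∣∧∤⇒IsValuation {a = a} (divides x′ refl) p^[1+a]∤x =
    exactly x′ (*-comm x′ (p ^ a)) λ p∣x′ →
      p^[1+a]∤x (subst₂ _∣_ (*-comm (p ^ a) p) (*-comm (p ^ a) x′) (*-monoʳ-∣ (p ^ a) p∣x′))

  IsValuation-* : ∀ {x y a b} → IsValuation x a → IsValuation y b → IsValuation (x * y) (a + b)
  IsValuation-* {a = a} {b} (exactly x′ refl p∤x′) (exactly y′ refl p∤y′) =
    exactly (x′ * y′) (trans (regroup (p ^ a) (p ^ b) x′ y′) (cong (_* (x′ * y′)) (sym (^-distribˡ-+-* p a b))))
                      (p∤m*n p∤x′ p∤y′)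
    where
    regroup : ∀ A B x y → A * x * (B * y) ≡ A * B * (x * y)
    regroup = solve-∀

  p^maxPowDiv∣ : ∀ K x → p ^ maxPowDiv p K x ∣ x
  p^maxPowDiv∣ zero    x = 1∣ x
  p^maxPowDiv∣ (suc K) x with p ^ suc K ∣? x
  ... | yes p^[1+K]∣x = p^[1+K]∣x
  ... | no  _         = p^maxPowDiv∣ K x

  ≤maxPowDiv : ∀ {K x j} → j ≤ K → p ^ j ∣ x → j ≤ maxPowDiv p K x
  ≤maxPowDiv {zero}  z≤n _ = z≤n
  ≤maxPowDiv {suc K} {x} {j} j≤1+K p^j∣x with p ^ suc K ∣? x
  ... | yes _ = j≤1+K
  ... | no p^[1+K]∤x with m≤n⇒m<n∨m≡n j≤1+K
  ...   | inj₁ j<1+K = ≤maxPowDiv (≤-pred j<1+K) p^j∣x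
  ...   | inj₂ refl  = contradiction p^j∣x p^[1+K]∤x

  valuation : ∀ {x} → 1 ≤ x → ∃ (IsValuation x)
  valuation {x@(suc _)} _ = u , ∣∧∤⇒IsValuation {a = u} (p^maxPowDiv∣ x x) p^[1+u]∤x
    where
    u = maxPowDiv p x x
    p^[1+u]∤x : ¬ p ^ suc u ∣ x
    p^[1+u]∤x p^[1+u]∣x = 1+n≰n (≤maxPowDiv {j = suc u} (<⇒≤ (<-≤-trans (n<p^n (suc u)) (∣⇒≤ p^[1+u]∣x))) p^[1+u]∣x)

  IsValuation-C : ∀ {N w r} → IsValuation (suc N) (w + r) → IsValuation (suc N C p ^ r) w
  IsValuation-C {N} {w} {r} (exactly τ′ 1+N≡ p∤τ′) =
    exactly (τ′ * (N C k)) (*-cancelˡ-≡ _ _ (p ^ r) {{m^n≢0 p r}} scaled) (p∤m*n p∤τ′ p∤NCk)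
    where
    k = pred (p ^ r)
    1+k≡p^r : suc k ≡ p ^ r
    1+k≡p^r = suc-pred (p ^ r) {{m^n≢0 p r}}
    regroup : ∀ A B x y → A * B * x * y ≡ B * (A * (x * y))
    regroup = solve-∀
    p^r∣1+N : p ^ r ∣ suc N
    p^r∣1+N = divides (p ^ w * τ′) (trans 1+N≡ (trans (cong (_* τ′) (^-distribˡ-+-* p w r)) (comm (p ^ w) (p ^ r) τ′)))
      where
      comm : ∀ A B x → A * B * x ≡ A * x * B
      comm = solve-∀
    p∤NCk : ¬ p ∣ N C k
    p∤NCk = p^r∣1+N⇒p∤NCi r p^r∣1+N (subst (k <_) 1+k≡p^r ≤-refl)
    scaled : p ^ r * (suc N C p ^ r) ≡ p ^ r * (p ^ w * (τ′ * (N C k)))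
    scaled = begin
      p ^ r * (suc N C p ^ r)         ≡⟨ cong (λ j → j * (suc N C j)) 1+k≡p^r ⟨
      suc k * (suc N C suc k)         ≡⟨ C-absorption N k ⟩
      suc N * (N C k)                 ≡⟨ cong (_* (N C k)) 1+N≡ ⟩
      p ^ (w + r) * τ′ * (N C k)      ≡⟨ cong (λ z → z * τ′ * (N C k)) (^-distribˡ-+-* p w r) ⟩
      p ^ w * p ^ r * τ′ * (N C k)    ≡⟨ regroup (p ^ w) (p ^ r) τ′ (N C k) ⟩
      p ^ r * (p ^ w * (τ′ * (N C k))) ∎
      where open ≡-Reasoning

module FiniteSums where

  open import Data.Integer using (ℤ; 0ℤ; _+_)
  open import Data.Integer.Properties using (+-identityˡ; +-assoc; +-comm)
  open import Data.Integer.Divisibility.Signed using (_∣_; divides; ∣m∣n⇒∣m+n; ∣m+n∣m⇒∣n; ∣m+n∣n⇒∣m)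
  open import Data.Integer.Tactic.RingSolver using (solve-∀)
  open import Data.Nat as ℕ using (ℕ; zero; suc; s≤s; z≤n)
  open import Data.Nat.Properties using (suc-injective)
  open import Function using (_∘_)
  open import Relation.Nullary using (¬_)
  open import Relation.Binary.PropositionalEquality

  ∑ : ℕ → (ℕ → ℤ) → ℤ
  ∑ zero    F = 0ℤ
  ∑ (suc n) F = F 0 + ∑ n (F ∘ suc)

  infix 5 ∑
  syntax ∑ n (λ i → e) = ∑[ i < n ] e

  ∑-cong : ∀ n {F G} → (∀ i → F i ≡ G i) → ∑ n F ≡ ∑ n G
  ∑-cong zero    F≗G = refl
  ∑-cong (suc n) F≗G = cong₂ _+_ (F≗G 0) (∑-cong n (F≗G ∘ suc))

  ∑-zero : ∀ n → ∑[ i < n ] 0ℤ ≡ 0ℤ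
  ∑-zero zero    = refl
  ∑-zero (suc n) = trans (+-identityˡ _) (∑-zero n)

  ∑-snoc : ∀ n F → ∑ (suc n) F ≡ ∑ n F + F n
  ∑-snoc zero    F = +-comm (F 0) 0ℤ
  ∑-snoc (suc n) F = trans (cong (_+_ (F 0)) (∑-snoc n (F ∘ suc))) (sym (+-assoc (F 0) _ _))

  ∑-distrib-+ : ∀ n F G → ∑[ i < n ] (F i + G i) ≡ ∑ n F + ∑ n G
  ∑-distrib-+ zero    F G = refl
  ∑-distrib-+ (suc n) F G = trans (cong (_+_ (F 0 + G 0)) (∑-distrib-+ n (F ∘ suc) (G ∘ suc))) (interchange (F 0) (G 0) _ _)
    where
    interchange : ∀ a b c d → a + b + (c + d) ≡ a + c + (b + d)
    interchange = solve-∀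

  ∑-∣ : ∀ {d} n F → (∀ i → i ℕ.< n → d ∣ F i) → d ∣ ∑ n F
  ∑-∣ zero    F _   = divides 0ℤ refl
  ∑-∣ (suc n) F d∣F = ∣m∣n⇒∣m+n (d∣F 0 (s≤s z≤n)) (∑-∣ n (F ∘ suc) (λ i i<n → d∣F (suc i) (s≤s i<n)))

  ∑-∤ : ∀ {d} n F j → j ℕ.< n → (∀ i → i ℕ.< n → i ≢ j → d ∣ F i) → ¬ d ∣ F j → ¬ d ∣ ∑ n F
  ∑-∤ (suc n) F zero    _         d∣F d∤Fj d∣∑ =
    d∤Fj (∣m+n∣n⇒∣m d∣∑ (∑-∣ n (F ∘ suc) (λ i i<n → d∣F (suc i) (s≤s i<n) λ ())))
  ∑-∤ (suc n) F (suc j) (s≤s j<n) d∣F d∤Fj d∣∑ =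
    ∑-∤ n (F ∘ suc) j j<n (λ i i<n i≢j → d∣F (suc i) (s≤s i<n) (i≢j ∘ suc-injective)) d∤Fj
      (∣m+n∣m⇒∣n d∣∑ (d∣F 0 (s≤s z≤n) λ ()))

module NewtonSeries where

  open import Data.Integer using (ℤ; +_; 0ℤ; _+_; _*_; _-_)
  open import Data.Integer.Properties using (+-identityʳ; *-identityʳ; *-zeroˡ; +-comm; *-distribˡ-+; *-distribʳ-+)
  open import Data.Integer.Divisibility.Signed
    using (_∣_; divides; ∣ᵤ⇒∣; ∣m∣n⇒∣m-n; ∣m⇒∣m*n; ∣m∣n⇒∣m+n; ∣m+n∣m⇒∣n)
  open import Data.Integer.Tactic.RingSolver using (solve-∀)
  open import Data.Nat as ℕ using (ℕ; zero; suc; s≤s; _≤_; _∸_)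
  open import Data.Nat.Properties using (+-suc; n<1+n; n≤1+n; ≤-trans; ≤-reflexive; m∸n+n≡m)
  open import Data.Nat.Combinatorics using (_C_; nCk+nC[k+1]≡[n+1]C[k+1]; k>n⇒nCk≡0)
  open import Function using (_∘_)
  open import Relation.Nullary using (¬_)
  open import Relation.Binary.PropositionalEquality

  open FiniteSums

  newton : (ℕ → ℤ) → ℕ → ℤ
  newton c n = ∑[ i < (suc n) ] c i * + (n C i)

  newton-cong : ∀ {c d} → (∀ i → c i ≡ d i) → ∀ n → newton c n ≡ newton d n
  newton-cong c≗d n = ∑-cong (suc n) (λ i → cong (_* + (n C i)) (c≗d i))

  newton-suc : ∀ c n → newton c (suc n) ≡ newton c n + newton (c ∘ suc) n
  newton-suc c n = begin
    c 0 * + 1 + (∑[ i < (suc n) ] c (suc i) * + (suc n C suc i))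
      ≡⟨ cong (_+_ (c 0 * + 1)) (∑-cong (suc n) pascal) ⟩
    c 0 * + 1 + (∑[ i < (suc n) ] (c (suc i) * + (n C i) + c (suc i) * + (n C suc i)))
      ≡⟨ cong (_+_ (c 0 * + 1)) (∑-distrib-+ (suc n) (λ i → c (suc i) * + (n C i)) (λ i → c (suc i) * + (n C suc i))) ⟩
    c 0 * + 1 + (newton (c ∘ suc) n + (∑[ i < (suc n) ] c (suc i) * + (n C suc i)))
      ≡⟨ cong (λ s → c 0 * + 1 + (newton (c ∘ suc) n + s)) (∑-snoc n _) ⟩
    c 0 * + 1 + (newton (c ∘ suc) n + ((∑[ i < n ] c (suc i) * + (n C suc i)) + c (suc n) * + (n C suc n)))
      ≡⟨ cong (λ x → c 0 * + 1 + (newton (c ∘ suc) n + ((∑[ i < n ] c (suc i) * + (n C suc i)) + c (suc n) * + x)))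
              (k>n⇒nCk≡0 (n<1+n n)) ⟩
    c 0 * + 1 + (newton (c ∘ suc) n + ((∑[ i < n ] c (suc i) * + (n C suc i)) + c (suc n) * 0ℤ))
      ≡⟨ regroup (c 0 * + 1) (newton (c ∘ suc) n) _ (c (suc n)) ⟩
    newton c n + newton (c ∘ suc) n ∎
    where
    open ≡-Reasoning
    pascal : ∀ i → c (suc i) * + (suc n C suc i) ≡ c (suc i) * + (n C i) + c (suc i) * + (n C suc i)
    pascal i = trans (cong (λ x → c (suc i) * + x) (sym (nCk+nC[k+1]≡[n+1]C[k+1] n i)))
                     (*-distribˡ-+ (c (suc i)) (+ (n C i)) (+ (n C suc i)))
    regroup : ∀ a A B x → a + (A + (B + x * 0ℤ)) ≡ a + B + A
    regroup = solve-∀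

  Δ-newton : ∀ c n → Δ (newton c) n ≡ newton (c ∘ suc) n
  Δ-newton c n = trans (cong (_- newton c n) (newton-suc c n)) (cancel (newton c n) _)
    where
    cancel : ∀ a b → a + b - a ≡ b
    cancel = solve-∀

  Δ-cong : ∀ {g h} → (∀ n → g n ≡ h n) → ∀ n → Δ g n ≡ Δ h n
  Δ-cong g≗h n = cong₂ _-_ (g≗h (suc n)) (g≗h n)

  Δ^-newton : ∀ c k n → iter k Δ (newton c) n ≡ newton (c ∘ (k ℕ.+_)) n
  Δ^-newton c zero    n = refl
  Δ^-newton c (suc k) n = begin
    Δ (iter k Δ (newton c)) n      ≡⟨ Δ-cong (Δ^-newton c k) n ⟩
    Δ (newton (c ∘ (k ℕ.+_))) n    ≡⟨ Δ-newton (c ∘ (k ℕ.+_)) n ⟩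
    newton (c ∘ (k ℕ.+_) ∘ suc) n  ≡⟨ newton-cong (λ i → cong c (+-suc k i)) n ⟩
    newton (c ∘ (suc k ℕ.+_)) n    ∎
    where open ≡-Reasoning

  genComp-Δ : ∀ g k → genComp (Δ g) k ≡ genComp g (suc k)
  genComp-Δ g k = cong (λ h → h 0) (iter-Δ-comm k)
    where
    iter-Δ-comm : ∀ k → iter k Δ (Δ g) ≡ Δ (iter k Δ g)
    iter-Δ-comm zero    = refl
    iter-Δ-comm (suc k) = cong Δ (iter-Δ-comm k)

  newton-genComp : ∀ g n → g n ≡ newton (genComp g) n
  newton-genComp g zero    = sym (trans (+-identityʳ _) (*-identityʳ (g 0)))
  newton-genComp g (suc n) = begin
    g (suc n)                                         ≡⟨ sym (cancel (g (suc n)) (g n)) ⟩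
    g n + Δ g n                                       ≡⟨ cong₂ _+_ (newton-genComp g n) (newton-genComp (Δ g) n) ⟩
    newton (genComp g) n + newton (genComp (Δ g)) n   ≡⟨ cong (_+_ (newton (genComp g) n)) (newton-cong (genComp-Δ g) n) ⟩
    newton (genComp g) n + newton (genComp g ∘ suc) n ≡⟨ sym (newton-suc (genComp g) n) ⟩
    newton (genComp g) (suc n)                        ∎
    where
    open ≡-Reasoning
    cancel : ∀ a b → b + (a - b) ≡ a
    cancel = solve-∀

  shift : (ℕ → ℤ) → ℕ → ℤ
  shift c zero    = 0ℤ
  shift c (suc k) = c k

  Σop-cong : ∀ {g h} → (∀ n → g n ≡ h n) → ∀ n → Σop g n ≡ Σop h n
  Σop-cong g≗h zero    = refl
  Σop-cong g≗h (suc n) = cong₂ _+_ (g≗h n) (Σop-cong g≗h n)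

  Σop-newton : ∀ c n → Σop (newton c) n ≡ newton (shift c) n
  Σop-newton c zero    = refl
  Σop-newton c (suc n) = begin
    newton c n + Σop (newton c) n          ≡⟨ cong (_+_ (newton c n)) (Σop-newton c n) ⟩
    newton c n + newton (shift c) n        ≡⟨ +-comm (newton c n) _ ⟩
    newton (shift c) n + newton c n        ≡⟨ sym (newton-suc (shift c) n) ⟩
    newton (shift c) (suc n)               ∎
    where open ≡-Reasoning

  Σop^-newton : ∀ {g c} → (∀ n → g n ≡ newton c n) → ∀ j n → iter j Σop g n ≡ newton (iter j shift c) n
  Σop^-newton g≗c zero    n = g≗c n
  Σop^-newton {c = c} g≗c (suc j) n = trans (Σop-cong (Σop^-newton g≗c j) n) (Σop-newton (iter j shift c) n)

  newton-+ : ∀ c d n → newton (λ k → c k + d k) n ≡ newton c n + newton d n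
  newton-+ c d n = trans (∑-cong (suc n) (λ i → *-distribʳ-+ (+ (n C i)) (c i) (d i)))
                         (∑-distrib-+ (suc n) (λ i → c i * + (n C i)) (λ i → d i * + (n C i)))

  shiftSum : (ℕ → ℤ) → ℕ → ℕ → ℤ
  shiftSum e zero    k = e k
  shiftSum e (suc t) k = shiftSum e t k + iter (suc t) shift e k

  sumΣ-newton : ∀ f t n → sumΣ f t n ≡ newton (shiftSum (genComp f) t) n
  sumΣ-newton f zero    n = newton-genComp f n
  sumΣ-newton f (suc t) n = begin
    sumΣ f t n + iter (suc t) Σop f n
      ≡⟨ cong₂ _+_ (sumΣ-newton f t n) (Σop^-newton (newton-genComp f) (suc t) n) ⟩
    newton (shiftSum (genComp f) t) n + newton (iter (suc t) shift (genComp f)) n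
      ≡⟨ sym (newton-+ (shiftSum (genComp f) t) (iter (suc t) shift (genComp f)) n) ⟩
    newton (shiftSum (genComp f) (suc t)) n ∎
    where open ≡-Reasoning

  shift^-at : ∀ c j i → iter j shift c (j ℕ.+ i) ≡ c i
  shift^-at c zero    i = refl
  shift^-at c (suc j) i = shift^-at c j i

  shift^-∣ : ∀ {d c} → (∀ i → d ∣ c i) → ∀ j k → d ∣ iter j shift c k
  shift^-∣ d∣c zero    k       = d∣c k
  shift^-∣ d∣c (suc j) zero    = divides 0ℤ refl
  shift^-∣ d∣c (suc j) (suc k) = shift^-∣ d∣c j k

  shift^-∣-from : ∀ {d c A} → (∀ i → A ≤ i → d ∣ c i) → ∀ j k → j ℕ.+ A ≤ k → d ∣ iter j shift c k
  shift^-∣-from d∣c zero    k       A≤k         = d∣c k A≤k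
  shift^-∣-from d∣c (suc j) (suc k) (s≤s j+A≤k) = shift^-∣-from d∣c j k j+A≤k

  shiftSum-∣ : ∀ {d e} → (∀ i → d ∣ e i) → ∀ t k → d ∣ shiftSum e t k
  shiftSum-∣ d∣e zero    k = d∣e k
  shiftSum-∣ d∣e (suc t) k = ∣m∣n⇒∣m+n (shiftSum-∣ d∣e t k) (shift^-∣ d∣e (suc t) k)

  shiftSum-∣-from : ∀ {d e A} → (∀ i → A ≤ i → d ∣ e i) → ∀ t k → t ℕ.+ A ≤ k → d ∣ shiftSum e t k
  shiftSum-∣-from d∣e zero    k A≤k     = d∣e k A≤k
  shiftSum-∣-from d∣e (suc t) k t+A<k =
    ∣m∣n⇒∣m+n (shiftSum-∣-from d∣e t k (≤-trans (n≤1+n _) t+A<k)) (shift^-∣-from d∣e (suc t) k t+A<k)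

  shiftSum-∤ : ∀ {d e γ} → (∀ i → suc γ ≤ i → d ∣ e i) → ¬ d ∣ e γ → ∀ t → ¬ d ∣ shiftSum e t (t ℕ.+ γ)
  shiftSum-∤ d∣e d∤eγ zero    = d∤eγ
  shiftSum-∤ {d} {e} {γ} d∣e d∤eγ (suc t) d∣sum =
    d∤eγ (subst (d ∣_) (shift^-at e (suc t) γ)
                 (∣m+n∣m⇒∣n d∣sum (shiftSum-∣-from d∣e t (suc t ℕ.+ γ) (≤-reflexive (+-suc t γ)))))

  impulse : ℤ → ℕ → ℤ
  impulse c zero    = c
  impulse c (suc k) = 0ℤ

  const-newton : ∀ c n → const[ c ] n ≡ newton (impulse c) n
  const-newton c n = sym (begin
    c * + 1 + (∑[ i < n ] 0ℤ * + (n C suc i))  ≡⟨ cong (_+_ (c * + 1)) (∑-cong n (λ i → *-zeroˡ (+ (n C suc i)))) ⟩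
    c * + 1 + (∑[ i < n ] 0ℤ)                  ≡⟨ cong (_+_ (c * + 1)) (∑-zero n) ⟩
    c * + 1 + 0ℤ                               ≡⟨ +-identityʳ (c * + 1) ⟩
    c * + 1                                    ≡⟨ *-identityʳ c ⟩
    c                                          ∎)
    where open ≡-Reasoning

  impulse-∣ : ∀ {d x} → d ∣ x → ∀ i → d ∣ impulse x i
  impulse-∣ d∣x zero    = d∣x
  impulse-∣ d∣x (suc i) = divides 0ℤ refl

  impulse-∣-from : ∀ {d x} i → 1 ≤ i → d ∣ impulse x i
  impulse-∣-from (suc i) _ = divides 0ℤ refl

  newton-∣ : ∀ {d c} → (∀ i → d ∣ c i) → ∀ n → d ∣ newton c n
  newton-∣ {c = c} d∣c n = ∑-∣ (suc n) _ (λ i _ → ∣m⇒∣m*n (+ (n C i)) (d∣c i))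

  iter-+ : ∀ a b (F : Seq → Seq) g → iter (a ℕ.+ b) F g ≡ iter a F (iter b F g)
  iter-+ zero    b F g = refl
  iter-+ (suc a) b F g = cong F (iter-+ a b F g)

  Δ^-∣ : ∀ {d g} → (∀ n → d ∣ g n) → ∀ k n → d ∣ iter k Δ g n
  Δ^-∣ d∣g zero    n = d∣g n
  Δ^-∣ d∣g (suc k) n = ∣m∣n⇒∣m-n (Δ^-∣ d∣g k (suc n)) (Δ^-∣ d∣g k n)

  NilpotentAt⇒Δ^-∣ : ∀ {M f η} → NilpotentAt M f η → ∀ k → η ≤ k → ∀ n → + M ∣ iter k Δ f n
  NilpotentAt⇒Δ^-∣ {M} {f} {η} nil k η≤k n =
    subst (λ j → + M ∣ iter j Δ f n) (m∸n+n≡m η≤k)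
      (subst (λ h → + M ∣ h n) (sym (iter-+ (k ∸ η) η Δ f))
        (Δ^-∣ (λ n → subst (+ M ∣_) (+-identityʳ _) (∣ᵤ⇒∣ (nil n))) (k ∸ η) n))

module Periodicity where

  open import Data.Integer using (ℤ; +_; 0ℤ; _+_; _*_; _-_)
  open import Data.Integer.Divisibility.Signed using (_∣_; ∣ᵤ⇒∣; ∣⇒∣ᵤ; ∣m∣n⇒∣m-n; ∣m∣n⇒∣m+n)
  open import Data.Integer.Tactic.RingSolver using (solve-∀)
  open import Data.Nat as ℕ using (ℕ; zero; suc; s≤s; z≤n)
  open import Data.Nat.Combinatorics using (_C_)
  open import Data.Product using (_,_)
  open import Function using (_∘_)
  open import Relation.Binary.PropositionalEquality

  open FiniteSums
  open NewtonSeries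

  IsPeriod⇒∣ : ∀ {M τ} g → IsPeriod M g τ → ∀ n → + M ∣ g (n ℕ.+ τ) - g n
  IsPeriod⇒∣ g per n = ∣ᵤ⇒∣ (per n)

  ∣⇒IsPeriod : ∀ {M τ} g → (∀ n → + M ∣ g (n ℕ.+ τ) - g n) → IsPeriod M g τ
  ∣⇒IsPeriod g M∣ n = ∣⇒∣ᵤ (M∣ n)

  IsPeriod-Δ : ∀ {M g τ} → IsPeriod M g τ → IsPeriod M (Δ g) τ
  IsPeriod-Δ {M} {g} {τ} per = ∣⇒IsPeriod (Δ g) λ n →
    subst (+ M ∣_) (swap (g (suc n ℕ.+ τ)) (g (n ℕ.+ τ)) (g (suc n)) (g n))
          (∣m∣n⇒∣m-n (IsPeriod⇒∣ g per (suc n)) (IsPeriod⇒∣ g per n))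
    where
    swap : ∀ a b c d → (a - c) - (b - d) ≡ (a - b) - (c - d)
    swap = solve-∀

  IsPeriod⇒Δ^-returns : ∀ {M g τ} → IsPeriod M g τ → ∀ k → + M ∣ iter k Δ g τ - iter k Δ g 0
  IsPeriod⇒Δ^-returns {M} {g} {τ} per k = IsPeriod⇒∣ (iter k Δ g) (Δ^-period k) 0
    where
    Δ^-period : ∀ k → IsPeriod M (iter k Δ g) τ
    Δ^-period zero    = per
    Δ^-period (suc k) = IsPeriod-Δ {g = iter k Δ g} (Δ^-period k)

  Δ^-returns⇒IsPeriod : ∀ {M g τ} → (∀ k → + M ∣ iter k Δ g τ - iter k Δ g 0) → IsPeriod M g τ
  Δ^-returns⇒IsPeriod {M} {g} {τ} returns = ∣⇒IsPeriod g (λ n → returns-from n 0)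
    where
    returns-from : ∀ n k → + M ∣ iter k Δ g (n ℕ.+ τ) - iter k Δ g n
    returns-from zero    k = returns k
    returns-from (suc n) k =
      subst (+ M ∣_) (telescope (iter k Δ g (suc n ℕ.+ τ)) (iter k Δ g (n ℕ.+ τ)) (iter k Δ g (suc n)) (iter k Δ g n))
            (∣m∣n⇒∣m+n (returns-from n k) (returns-from n (suc k)))
      where
      telescope : ∀ a b c d → (b - d) + ((a - b) - (c - d)) ≡ a - c
      telescope = solve-∀

  increment : (ℕ → ℤ) → ℕ → ℕ → ℤ
  increment c τ k = ∑[ i < τ ] c (k ℕ.+ suc i) * + (τ C suc i)

  newton-Δ^-return : ∀ c τ k → iter k Δ (newton c) τ - iter k Δ (newton c) 0 ≡ increment c τ k
  newton-Δ^-return c τ k =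
    trans (cong₂ _-_ (Δ^-newton c k τ) (Δ^-newton c k 0)) (cancel (c (k ℕ.+ 0) * + 1) (increment c τ k))
    where
    cancel : ∀ a s → (a + s) - (a + 0ℤ) ≡ s
    cancel = solve-∀

  IsPeriod⇒increment-∣ : ∀ {M c τ} → IsPeriod M (newton c) τ → ∀ k → + M ∣ increment c τ k
  IsPeriod⇒increment-∣ {M} {c} {τ} per k = subst (+ M ∣_) (newton-Δ^-return c τ k) (IsPeriod⇒Δ^-returns per k)

  increment-∣⇒IsPeriod : ∀ {M c τ} → (∀ k → + M ∣ increment c τ k) → IsPeriod M (newton c) τ
  increment-∣⇒IsPeriod {M} {c} {τ} M∣inc =
    Δ^-returns⇒IsPeriod (λ k → subst (+ M ∣_) (sym (newton-Δ^-return c τ k)) (M∣inc k))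

  IsPeriod-resp : ∀ {M g h} → (∀ n → g n ≡ h n) → ∀ {τ} → IsPeriod M g τ → IsPeriod M h τ
  IsPeriod-resp {M} g≗h {τ} per n = subst₂ (λ a b → a ≡[ M ] b) (g≗h (n ℕ.+ τ)) (g≗h n) (per n)

  IsMinPeriod-resp : ∀ {M g h} → (∀ n → g n ≡ h n) → ∀ {τ} → IsMinPeriod M g τ → IsMinPeriod M h τ
  IsMinPeriod-resp g≗h (1≤τ , per , minimal) =
    1≤τ , IsPeriod-resp g≗h per , λ τ′ 1≤τ′ per′ → minimal τ′ 1≤τ′ (IsPeriod-resp (sym ∘ g≗h) per′)

  vanishing⇒IsMinPeriod-1 : ∀ {M g} → (∀ n → + M ∣ g n) → IsMinPeriod M g 1
  vanishing⇒IsMinPeriod-1 {g = g} M∣g =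
    s≤s z≤n , ∣⇒IsPeriod g (λ n → ∣m∣n⇒∣m-n (M∣g (n ℕ.+ 1)) (M∣g n)) , λ _ 1≤τ′ _ → 1≤τ′

module LeadingTerm {p : ℕ} (p-prime : Prime p) where

  open import Data.Nat as ℕ using (zero; suc; pred; _≤_; _<_; _∸_; s≤s; z≤n; _≤?_)
  open import Data.Nat.Properties
  open import Data.Nat.Divisibility as ℕ using () renaming (_∣_ to _∣ℕ_)
  open import Data.Nat.Combinatorics using (_C_)
  open import Data.Integer as ℤ using (ℤ; +_; ∣_∣)
  open import Data.Integer.Properties using (abs-*)
  open import Data.Integer.Divisibility.Signed using (_∣_; ∣ᵤ⇒∣; ∣⇒∣ᵤ; ∣-trans; ∣m⇒∣m*n)
  open import Data.Product using (∃₂; _×_; _,_)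
  open import Data.Sum using (_⊎_; inj₁; inj₂)
  open import Relation.Nullary using (¬_; yes; no; contradiction)
  open import Relation.Binary.PropositionalEquality
  open import Relation.Binary.Definitions using (tri<; tri≈; tri>)
  open import Function using (_∘_)
  open FiniteSums
  open NewtonSeries
  open Periodicity
  open PAdic p-prime

  P : ℕ → ℤ
  P n = + (p ^ n)

  P-mono : ∀ {x} i j → i ≤ j → P j ∣ x → P i ∣ x
  P-mono i j i≤j = ∣-trans (∣ᵤ⇒∣ (p^-mono-∣ i≤j))

  P-∣-* : ∀ {x n} a b → P a ∣ x → p ^ b ∣ℕ n → P (a ℕ.+ b) ∣ x ℤ.* + n
  P-∣-* {x} {n} a b P^a∣x p^b∣n =
    ∣ᵤ⇒∣ (subst₂ _∣ℕ_ (sym (^-distribˡ-+-* p a b)) (sym (abs-* x (+ n))) (ℕ.*-pres-∣ (∣⇒∣ᵤ P^a∣x) p^b∣n))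

  ∣∧∤⇒IsValuation-ℤ : ∀ {a x} → P a ∣ x → ¬ P (suc a) ∣ x → IsValuation ∣ x ∣ a
  ∣∧∤⇒IsValuation-ℤ P^a∣x P^[1+a]∤x = ∣∧∤⇒IsValuation (∣⇒∣ᵤ P^a∣x) (P^[1+a]∤x ∘ ∣ᵤ⇒∣)

  IsValuation⇒∤-* : ∀ {a b x n} → IsValuation ∣ x ∣ a → IsValuation n b → ¬ P (suc (a ℕ.+ b)) ∣ x ℤ.* + n
  IsValuation⇒∤-* {x = x} {n} val-x val-n P∣xn =
    IsValuation⇒∤ (IsValuation-* val-x val-n) (subst (_ ∣ℕ_) (abs-* x (+ n)) (∣⇒∣ᵤ P∣xn))

  record LeadingProfile (c : ℕ → ℤ) (m v M B : ℕ) : Set where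
    field
      divisible       : ∀ k → P v ∣ c k
      divisible-after : ∀ k → m < k → P (suc v) ∣ c k
      exact-at        : ¬ P (suc v) ∣ c m
      vanishing-from  : ∀ k → B ≤ k → P M ∣ c k

  module MinimalPeriod {c : ℕ → ℤ} {m v a B L : ℕ}
    (profile : LeadingProfile c m v (suc v ℕ.+ a) B)
    (p^L≤m : p ^ L ≤ m) (m<p^[1+L] : m < p ^ suc L)
    (B+p^L≤m+p^[1+L] : B ℕ.+ p ^ L ≤ m ℕ.+ p ^ suc L) where

    open LeadingProfile profile

    M : ℕ
    M = suc v ℕ.+ a

    s : ℕ
    s = suc a ℕ.+ L

    p^s∣τ⇒P^M∣increment : ∀ {τ} → p ^ s ∣ℕ τ → ∀ k → P M ∣ increment c τ k
    p^s∣τ⇒P^M∣increment {τ} p^s∣τ k = ∑-∣ τ _ (λ i _ → term i)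
      where
      term : ∀ i → P M ∣ c (k ℕ.+ suc i) ℤ.* + (τ C suc i)
      term i with B ≤? k ℕ.+ suc i | k ℕ.+ suc i ≤? m
      ... | yes B≤k+1+i | _ = ∣m⇒∣m*n _ (vanishing-from _ B≤k+1+i)
      ... | no _ | yes k+1+i≤m =
        subst (λ e → P e ∣ c (k ℕ.+ suc i) ℤ.* + (τ C suc i)) (+-suc v a)
          (P-∣-* v (suc a) (divisible _) (p^[x+y]∣τ⇒p^x∣τCj (suc a) L p^s∣τ (s≤s z≤n) 1+i<p^[1+L]))
        where
        1+i<p^[1+L] : suc i < p ^ suc L
        1+i<p^[1+L] = ≤-<-trans (≤-trans (m≤n+m (suc i) k) k+1+i≤m) m<p^[1+L]
      ... | no B≰k+1+i | no k+1+i≰m =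
        P-∣-* (suc v) a (divisible-after _ (≰⇒> k+1+i≰m))
              (p^[x+y]∣τ⇒p^x∣τCj a (suc L) (subst (λ e → p ^ e ∣ℕ τ) (sym (+-suc a L)) p^s∣τ) (s≤s z≤n) 1+i<p^[2+L])
        where
        1+i<p^[2+L] : suc i < p ^ suc (suc L)
        1+i<p^[2+L] = begin-strict
          suc i                    ≤⟨ m≤n+m (suc i) k ⟩
          k ℕ.+ suc i              <⟨ ≰⇒> B≰k+1+i ⟩
          B                        ≤⟨ m≤m+n B (p ^ L) ⟩
          B ℕ.+ p ^ L              ≤⟨ B+p^L≤m+p^[1+L] ⟩
          m ℕ.+ p ^ suc L          <⟨ +-monoˡ-< (p ^ suc L) m<p^[1+L] ⟩
          p ^ suc L ℕ.+ p ^ suc L  ≤⟨ p^n+p^n≤p^[1+n] (suc L) ⟩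
          p ^ suc (suc L)          ∎
          where open ≤-Reasoning

    below-lead-∣ : ∀ {τ w r i} k → p ^ (w ℕ.+ r) ∣ℕ τ → suc i < p ^ r → P (suc v ℕ.+ w) ∣ c k ℤ.* + (τ C suc i)
    below-lead-∣ {r = zero}   k _ (s≤s ())
    below-lead-∣ {τ} {w} {suc r} {i} k p^[w+1+r]∣τ 1+i<p^[1+r] =
      subst (λ e → P e ∣ c k ℤ.* + (τ C suc i)) (+-suc v w)
        (P-∣-* v (suc w) (divisible k)
          (p^[x+y]∣τ⇒p^x∣τCj (suc w) r (subst (λ e → p ^ e ∣ℕ τ) (+-suc w r) p^[w+1+r]∣τ) (s≤s z≤n) 1+i<p^[1+r]))

    above-lead-∣ : ∀ {τ w r} k j → p ^ (w ℕ.+ r) ∣ℕ τ → w ≤ a → w ≡ 0 ⊎ r ≡ L → k ℕ.+ p ^ r ≡ m → p ^ r < j →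
                   P (suc v ℕ.+ w) ∣ c (k ℕ.+ j) ℤ.* + (τ C j)
    above-lead-∣ {τ} {w} {r} k j p^[w+r]∣τ w≤a w≡0⊎r≡L k+p^r≡m p^r<j with B ≤? k ℕ.+ j
    ... | yes B≤k+j = P-mono (suc v ℕ.+ w) M (+-monoʳ-≤ (suc v) w≤a) (∣m⇒∣m*n _ (vanishing-from _ B≤k+j))
    ... | no B≰k+j = P-∣-* (suc v) w (divisible-after _ m<k+j) (p^w∣τCj w≡0⊎r≡L)
      where
      m<k+j : m < k ℕ.+ j
      m<k+j = subst (_< k ℕ.+ j) k+p^r≡m (+-monoʳ-< k p^r<j)
      p^w∣τCj : w ≡ 0 ⊎ r ≡ L → p ^ w ∣ℕ τ C j
      p^w∣τCj (inj₁ refl) = ℕ.1∣ _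
      p^w∣τCj (inj₂ r≡L) =
        p^[x+y]∣τ⇒p^x∣τCj w L (subst (λ e → p ^ (w ℕ.+ e) ∣ℕ τ) r≡L p^[w+r]∣τ) (≤-trans (s≤s z≤n) p^r<j) j<p^[1+L]
        where
        j<p^[1+L] : j < p ^ suc L
        j<p^[1+L] = +-cancelʳ-< m j (p ^ suc L) (begin-strict
          j ℕ.+ m                  ≡⟨ cong (j ℕ.+_) (subst (λ e → k ℕ.+ p ^ e ≡ m) r≡L k+p^r≡m) ⟨
          j ℕ.+ (k ℕ.+ p ^ L)      ≡⟨ +-assoc j k (p ^ L) ⟨
          j ℕ.+ k ℕ.+ p ^ L        ≡⟨ cong (ℕ._+ p ^ L) (+-comm j k) ⟩
          k ℕ.+ j ℕ.+ p ^ L        <⟨ +-monoˡ-< (p ^ L) (≰⇒> B≰k+j) ⟩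
          B ℕ.+ p ^ L              ≤⟨ B+p^L≤m+p^[1+L] ⟩
          m ℕ.+ p ^ suc L          ≡⟨ +-comm m (p ^ suc L) ⟩
          p ^ suc L ℕ.+ m          ∎)
          where open ≤-Reasoning

    -- Evaluated at k₀ = m ∸ p ^ r, the increment has exactly one term of valuation v + w: the one
    -- through the leading coefficient c m.
    increment-∤ : ∀ {N w r} → IsValuation (suc N) (w ℕ.+ r) → r ≤ L → w ≤ a → w ≡ 0 ⊎ r ≡ L →
                  ¬ P (suc v ℕ.+ w) ∣ increment c (suc N) (m ∸ p ^ r)
    increment-∤ {N} {w} {r} val-τ r≤L w≤a w≡0⊎r≡L = ∑-∤ τ F j₀ j₀<τ others lead-∤
      where
      τ = suc N
      k₀ = m ∸ p ^ r
      j₀ = pred (p ^ r)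

      F : ℕ → ℤ
      F i = c (k₀ ℕ.+ suc i) ℤ.* + (τ C suc i)

      1+j₀≡p^r : suc j₀ ≡ p ^ r
      1+j₀≡p^r = suc-pred (p ^ r) {{m^n≢0 p r}}

      k₀+p^r≡m : k₀ ℕ.+ p ^ r ≡ m
      k₀+p^r≡m = m∸n+n≡m (≤-trans (^-monoʳ-≤ p r≤L) p^L≤m)

      p^[w+r]∣τ : p ^ (w ℕ.+ r) ∣ℕ τ
      p^[w+r]∣τ = IsValuation⇒∣ val-τ

      j₀<τ : j₀ < τ
      j₀<τ = subst (_≤ τ) (sym 1+j₀≡p^r) (ℕ.∣⇒≤ (ℕ.∣-trans (p^-mono-∣ (m≤n+m r w)) p^[w+r]∣τ))

      lead-∤ : ¬ P (suc v ℕ.+ w) ∣ F j₀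
      lead-∤ = subst (λ x → ¬ P (suc v ℕ.+ w) ∣ x) (sym F[j₀]≡)
        (IsValuation⇒∤-* {x = c m} (∣∧∤⇒IsValuation-ℤ {a = v} (divisible m) exact-at) (IsValuation-C {w = w} {r} val-τ))
        where
        F[j₀]≡ : F j₀ ≡ c m ℤ.* + (τ C p ^ r)
        F[j₀]≡ = trans (cong (λ j → c (k₀ ℕ.+ j) ℤ.* + (τ C j)) 1+j₀≡p^r)
                       (cong (λ k → c k ℤ.* + (τ C p ^ r)) k₀+p^r≡m)

      others : ∀ i → i < τ → i ≢ j₀ → P (suc v ℕ.+ w) ∣ F i
      others i _ i≢j₀ with <-cmp i j₀
      ... | tri< i<j₀ _ _ = below-lead-∣ {i = i} (k₀ ℕ.+ suc i) p^[w+r]∣τ (subst (suc i <_) 1+j₀≡p^r (s≤s i<j₀))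
      ... | tri≈ _ i≡j₀ _ = contradiction i≡j₀ i≢j₀
      ... | tri> _ _ j₀<i =
        above-lead-∣ k₀ (suc i) p^[w+r]∣τ w≤a w≡0⊎r≡L k₀+p^r≡m (subst (_< suc i) 1+j₀≡p^r (s≤s j₀<i))

    valuation-split : ∀ u → u < s → ∃₂ λ w r → u ≡ w ℕ.+ r × r ≤ L × w ≤ a × (w ≡ 0 ⊎ r ≡ L)
    valuation-split u u<s with u ≤? L
    ... | yes u≤L = 0 , u , refl , u≤L , z≤n , inj₁ refl
    ... | no  u≰L = u ∸ L , L , sym (m∸n+n≡m (<⇒≤ (≰⇒> u≰L))) , ≤-refl ,
                    m≤n+o⇒m∸n≤o u L (subst (u ≤_) (+-comm a L) (≤-pred u<s)) , inj₂ refl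

    IsPeriod⇒p^s∣ : ∀ {τ} → 1 ≤ τ → IsPeriod (p ^ M) (newton c) τ → p ^ s ∣ℕ τ
    IsPeriod⇒p^s∣ {suc N} _ per with valuation (s≤s (z≤n {N}))
    ... | u , val-τ with s ≤? u
    ...   | yes s≤u = ℕ.∣-trans (p^-mono-∣ s≤u) (IsValuation⇒∣ val-τ)
    ...   | no  s≰u with valuation-split u (≰⇒> s≰u)
    ...     | w , r , refl , r≤L , w≤a , w≡0⊎r≡L =
      contradiction (P-mono (suc v ℕ.+ w) M (+-monoʳ-≤ (suc v) w≤a) (IsPeriod⇒increment-∣ {c = c} per (m ∸ p ^ r)))
                    (increment-∤ val-τ r≤L w≤a w≡0⊎r≡L)

    newton-IsMinPeriod : IsMinPeriod (p ^ M) (newton c) (p ^ s)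
    newton-IsMinPeriod =
      m^n>0 p s ,
      increment-∣⇒IsPeriod {c = c} (p^s∣τ⇒P^M∣increment ℕ.∣-refl) ,
      λ { (suc τ′) 1≤τ′ per → ℕ.∣⇒≤ (IsPeriod⇒p^s∣ 1≤τ′ per) }

  val-∣ : ∀ {ℓ j x} → j ≤ val p ℓ x → P j ∣ x
  val-∣ {ℓ} {j} {x} j≤val = P-mono j (val p ℓ x) j≤val (∣ᵤ⇒∣ (p^maxPowDiv∣ ℓ ∣ x ∣))

  ∣⇒≤val : ∀ {ℓ j x} → j ≤ ℓ → P j ∣ x → j ≤ val p ℓ x
  ∣⇒≤val j≤ℓ P^j∣x = ≤maxPowDiv j≤ℓ (∣⇒∣ᵤ P^j∣x)

  shiftSum-LeadingProfile : ∀ {e m v M B} → LeadingProfile e m v M B → ∀ t →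
                            LeadingProfile (shiftSum e t) (t ℕ.+ m) v M (t ℕ.+ B)
  shiftSum-LeadingProfile {m = m} profile t = record
    { divisible       = shiftSum-∣ divisible t
    ; divisible-after = λ k t+m<k → shiftSum-∣-from divisible-after t k (≤-trans (≤-reflexive (+-suc t m)) t+m<k)
    ; exact-at        = shiftSum-∤ divisible-after exact-at t
    ; vanishing-from  = shiftSum-∣-from vanishing-from t
    }
    where open LeadingProfile profile

  impulse-LeadingProfile : ∀ {x v M} → P v ∣ x → ¬ P (suc v) ∣ x → ∀ m →
                           LeadingProfile (iter m shift (impulse x)) m v M (suc m)
  impulse-LeadingProfile {x} {v} P^v∣x P^[1+v]∤x m = record
    { divisible       = shift^-∣ (impulse-∣ P^v∣x) m
    ; divisible-after = λ k m<k → shift^-∣-from impulse-∣-from m k (≤-trans (≤-reflexive (+-comm m 1)) m<k)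
    ; exact-at        = P^[1+v]∤x ∘ subst (P (suc v) ∣_) at-m
    ; vanishing-from  = λ k m<k → shift^-∣-from impulse-∣-from m k (≤-trans (≤-reflexive (+-comm m 1)) m<k)
    }
    where
    at-m : iter m shift (impulse x) m ≡ x
    at-m = trans (cong (iter m shift (impulse x)) (sym (+-identityʳ m))) (shift^-at (impulse x) m 0)

module GeneratingVector {p : ℕ} (p-prime : Prime p) {ℓ : ℕ} (f : Seq) {η γ : ℕ}
  (nil-index : IsNilIndex (p ^ ℓ) f η) (leading : IsLeading p ℓ f η γ) where

  open import Data.Nat using (suc; _+_; _*_; _^_; _≤_; _<_; _<?_)
  open import Data.Nat.Properties
  open import Data.Integer using (ℤ)
  open import Data.Integer.Divisibility.Signed using (_∣_)
  open import Data.Product using (Σ; _×_; _,_; proj₁; proj₂)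
  open import Function using (_∘_)
  open import Relation.Nullary using (¬_; yes; no)
  open import Relation.Binary.PropositionalEquality
  open NewtonSeries
  open Periodicity
  open PAdic p-prime
  open LeadingTerm p-prime

  1≤η : 1 ≤ η
  1≤η = proj₁ nil-index

  Δ^ηf≡0 : NilpotentAt (p ^ ℓ) f η
  Δ^ηf≡0 = proj₁ (proj₂ nil-index)

  e : ℕ → ℤ
  e = genComp f

  v : ℕ
  v = val p ℓ (e γ)

  v≤val : ∀ i → i < η → v ≤ val p ℓ (e i)
  v≤val = proj₁ (proj₂ leading)

  v<val : ∀ i → γ < i → i < η → v < val p ℓ (e i)
  v<val = proj₂ (proj₂ leading)

  e-vanishing : ∀ k → η ≤ k → P ℓ ∣ e k
  e-vanishing k η≤k = NilpotentAt⇒Δ^-∣ Δ^ηf≡0 k η≤k 0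

  e-∣ : ∀ {j} → j ≤ v → j ≤ ℓ → ∀ k → P j ∣ e k
  e-∣ j≤v j≤ℓ k with k <? η
  ... | yes k<η = val-∣ {ℓ} {x = e k} (≤-trans j≤v (v≤val k k<η))
  ... | no  k≮η = P-mono _ ℓ j≤ℓ (e-vanishing k (≮⇒≥ k≮η))

  e-LeadingProfile : v < ℓ → LeadingProfile e γ v ℓ η
  e-LeadingProfile v<ℓ = record
    { divisible       = e-∣ ≤-refl (<⇒≤ v<ℓ)
    ; divisible-after = after
    ; exact-at        = λ P^[1+v]∣eγ → 1+n≰n (∣⇒≤val v<ℓ P^[1+v]∣eγ)
    ; vanishing-from  = e-vanishing
    }
    where
    after : ∀ k → γ < k → P (suc v) ∣ e k
    after k γ<k with k <? η
    ... | yes k<η = val-∣ {ℓ} {x = e k} (v<val k γ<k k<η)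
    ... | no  k≮η = P-mono (suc v) ℓ v<ℓ (e-vanishing k (≮⇒≥ k≮η))

  sumΣ-IsMinPeriod-1 : ¬ v < ℓ → ∀ t → IsMinPeriod (p ^ ℓ) (sumΣ f t) 1
  sumΣ-IsMinPeriod-1 v≮ℓ t =
    IsMinPeriod-resp (sym ∘ sumΣ-newton f t)
      (vanishing⇒IsMinPeriod-1 (newton-∣ (shiftSum-∣ (e-∣ (≮⇒≥ v≮ℓ) ≤-refl) t)))

  Σop^-const-IsMinPeriod-1 : ¬ v < ℓ → ∀ j → IsMinPeriod (p ^ ℓ) (iter j Σop const[ e γ ]) 1
  Σop^-const-IsMinPeriod-1 v≮ℓ j =
    IsMinPeriod-resp (sym ∘ Σop^-newton (const-newton (e γ)) j)
      (vanishing⇒IsMinPeriod-1 (newton-∣ (shift^-∣ (impulse-∣ (e-∣ (≮⇒≥ v≮ℓ) ≤-refl γ)) j)))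

  pη≤t⇒1≤t+γ : ∀ {t} → p * η ≤ t → 1 ≤ t + γ
  pη≤t⇒1≤t+γ {t} pη≤t = ≤-trans (*-mono-≤ (<⇒≤ 1<p) 1≤η) (≤-trans pη≤t (m≤m+n t γ))

  min-periods-agree : v < ℓ → ∀ t → p * η ≤ t → Σ ℕ λ τ →
    IsMinPeriod (p ^ ℓ) (sumΣ f t) τ × IsMinPeriod (p ^ ℓ) (iter (t + γ) Σop const[ e γ ]) τ
  min-periods-agree v<ℓ t pη≤t with m≤n⇒∃[o]m+o≡n v<ℓ | p^-bracket (pη≤t⇒1≤t+γ pη≤t)
  ... | a , 1+v+a≡ℓ | L , p^L≤m , m<p^[1+L] = p ^ (suc a + L) , sumΣ-minPeriod , Σop^-const-minPeriod
    where
    profile : LeadingProfile e γ v (suc v + a) η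
    profile = subst (λ M → LeadingProfile e γ v M η) (sym 1+v+a≡ℓ) (e-LeadingProfile v<ℓ)
    open LeadingProfile profile using (divisible; exact-at)
    open MinimalPeriod using (newton-IsMinPeriod)

    η<p^L : η < p ^ L
    η<p^L = *-cancelˡ-< p η (p ^ L) (≤-<-trans (≤-trans pη≤t (m≤m+n t γ)) m<p^[1+L])

    t+η≤m+p^L : t + η ≤ t + γ + p ^ L
    t+η≤m+p^L = ≤-trans (+-monoʳ-≤ t (≤-trans (<⇒≤ η<p^L) (m≤n+m (p ^ L) γ)))
                        (≤-reflexive (sym (+-assoc t γ (p ^ L))))

    1+m≤m+p^L : suc (t + γ) ≤ t + γ + p ^ L
    1+m≤m+p^L = ≤-trans (≤-reflexive (+-comm 1 (t + γ))) (+-monoʳ-≤ (t + γ) (m^n>0 p L))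

    sumΣ-minPeriod : IsMinPeriod (p ^ ℓ) (sumΣ f t) (p ^ (suc a + L))
    sumΣ-minPeriod = subst (λ M → IsMinPeriod (p ^ M) (sumΣ f t) (p ^ (suc a + L))) 1+v+a≡ℓ
      (IsMinPeriod-resp (sym ∘ sumΣ-newton f t)
        (newton-IsMinPeriod (shiftSum-LeadingProfile profile t) p^L≤m m<p^[1+L] (B≤m+p^L⇒B+p^L≤m+p^[1+L] L t+η≤m+p^L)))

    Σop^-const-minPeriod : IsMinPeriod (p ^ ℓ) (iter (t + γ) Σop const[ e γ ]) (p ^ (suc a + L))
    Σop^-const-minPeriod = subst (λ M → IsMinPeriod (p ^ M) (iter (t + γ) Σop const[ e γ ]) (p ^ (suc a + L))) 1+v+a≡ℓ
      (IsMinPeriod-resp (sym ∘ Σop^-newton (const-newton (e γ)) (t + γ))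
        (newton-IsMinPeriod (impulse-LeadingProfile {v = v} {M = suc v + a} (divisible γ) exact-at (t + γ))
                            p^L≤m m<p^[1+L] (B≤m+p^L⇒B+p^L≤m+p^[1+L] L 1+m≤m+p^L)))

open import Data.Nat using (_+_; _*_; _≤_; _<?_)
open import Data.Product using (Σ; _×_; _,_)
open import Function using (case_of_)
open import Relation.Nullary using (yes; no)

corollary3p6 : (p ℓ : ℕ) → Prime p → 1 ≤ ℓ → (f : Seq) → Periodic (p ^ ℓ) f
    → (η γ : ℕ) → IsNilIndex (p ^ ℓ) f η → IsLeading p ℓ f η γ
    → Σ ℕ λ T → ∀ t → T ≤ t → Σ ℕ λ τ →
        IsMinPeriod (p ^ ℓ) (sumΣ f t) τ
        × IsMinPeriod (p ^ ℓ) (iter (t + γ) Σop const[ genComp f γ ]) τ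
corollary3p6 p ℓ p-prime _ f _ η γ nil-index leading = case v <? ℓ of λ where
    (yes v<ℓ) → p * η , min-periods-agree v<ℓ
    (no  v≮ℓ) → 0 , λ t _ → 1 , sumΣ-IsMinPeriod-1 v≮ℓ t , Σop^-const-IsMinPeriod-1 v≮ℓ (t + γ)
  where open GeneratingVector p-prime {ℓ} f nil-index leading
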